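{- For integers $n>k\ge 2$, we have $|VC(2k,n;k)|=2\cdot|\mathrm{TComp}(n-k,k)|$.
   Context: Consider tilings of the $2k\times n$ rectangle $[0,n]\times[0,2k]$ (height $2k$, width $n$) by $k\times 1$ tiles (in either orientation). A tiling has a horizontal fault at $y=k$ if no tile interior meets the line $y=k$, and a vertical fault at $x=c$ ($0<c<n$ integer) if no tile interior meets the line $x=c$. $VC(2k,n;k)$ is the set of such tilings that have a horizontal fault at $y=k$ and no vertical fault. $\mathrm{TComp}(N,k)$ is the set of compositions (ordered sequences of positive integers) of $N$ all of whose parts are at most $k-1$ and in which every two consecutive parts have sum at least $k$ (for $N=0$ it consists of the empty composition). -}

module Defs where

open import Data.Nat using (ℕ; zero; suc; _+_; _*_; _∸_; _≤_; _<_)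
open import Data.Fin using (Fin; toℕ)
open import Data.Vec using (Vec; lookup)
open import Data.List using (List; []; _∷_)
open import Data.Nat.ListAction using (sum)
open import Data.List.Relation.Unary.All using (All)
open import Data.Product using (Σ; _×_; _,_)
open import Data.Unit using (⊤)
open import Data.Empty using (⊥)
open import Relation.Nullary using (¬_)
open import Relation.Binary.PropositionalEquality using (_≡_)
open import Data.Refinement using (Refinement)
open import Function.Bundles using (_↔_)

-- A tile is determined
-- by its orientation and its lower-left corner (i , j); we encode a set of
-- tiles as a w × h array of marks: mark at (i , j) says whether a
-- horizontal tile [i,i+k]×[j,j+1], a vertical tile [i,i+1]×[j,j+k], or no
-- tile has lower-left corner (i , j).

data Mark : Set where
  none horiz vert : Mark

Grid : ℕ → ℕ → Set
Grid h w = Vec (Vec Mark h) w     -- indexed by x ∈ Fin w, then y ∈ Fin h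

mark : ∀ {h w} → Grid h w → Fin w → Fin h → Mark
mark g x y = lookup (lookup g x) y

InBounds : ℕ → ℕ → ℕ → Mark → ℕ → ℕ → Set
InBounds h w k none  i j = ⊤
InBounds h w k horiz i j = (i + k ≤ w) × (j + 1 ≤ h)
InBounds h w k vert  i j = (i + 1 ≤ w) × (j + k ≤ h)

-- the tile (m, corner (i,j)) covers the unit cell [a,a+1]×[b,b+1]
Covers : ℕ → Mark → ℕ → ℕ → ℕ → ℕ → Set
Covers k none  i j a b = ⊥
Covers k horiz i j a b = (j ≡ b) × (i ≤ a) × (a < i + k)
Covers k vert  i j a b = (i ≡ a) × (j ≤ b) × (b < j + k)

IsTiling : (h w k : ℕ) → Grid h w → Set
IsTiling h w k g =
  (∀ (x : Fin w) (y : Fin h) → InBounds h w k (mark g x y) (toℕ x) (toℕ y))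
  × (∀ (a : Fin w) (b : Fin h) →
       Σ (Fin w × Fin h) λ { (x , y) →
         Covers k (mark g x y) (toℕ x) (toℕ y) (toℕ a) (toℕ b)
         × (∀ (x' : Fin w) (y' : Fin h) →
              Covers k (mark g x' y') (toℕ x') (toℕ y') (toℕ a) (toℕ b) →
              (x' ≡ x) × (y' ≡ y)) })

-- the (open) interior of the tile (m, corner (i,j)) meets the line y = c
MeetsHLine : ℕ → Mark → ℕ → ℕ → ℕ → Set
MeetsHLine k none  i j c = ⊥
MeetsHLine k horiz i j c = (j < c) × (c < j + 1)
MeetsHLine k vert  i j c = (j < c) × (c < j + k)

-- the (open) interior of the tile (m, corner (i,j)) meets the line x = c
MeetsVLine : ℕ → Mark → ℕ → ℕ → ℕ → Set
MeetsVLine k none  i j c = ⊥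
MeetsVLine k horiz i j c = (i < c) × (c < i + k)
MeetsVLine k vert  i j c = (i < c) × (c < i + 1)

HorizontalFault : ∀ {h w} → ℕ → Grid h w → ℕ → Set
HorizontalFault k g c =
  ∀ x y → ¬ MeetsHLine k (mark g x y) (toℕ x) (toℕ y) c

VerticalFault : ∀ {h w} → ℕ → Grid h w → ℕ → Set
VerticalFault k g c =
  ∀ x y → ¬ MeetsVLine k (mark g x y) (toℕ x) (toℕ y) c

-- VC(2k, n; k): tilings of the 2k × n rectangle (height 2k, width n) by
-- k×1 tiles with a horizontal fault at y = k and no vertical fault
-- x = c, 0 < c < n.
IsVC : (k n : ℕ) → Grid (2 * k) n → Set
IsVC k n g =
  IsTiling (2 * k) n k g
  × HorizontalFault k g k
  × (∀ c → 0 < c → c < n → ¬ VerticalFault k g c)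

VC : ℕ → ℕ → Set
VC k n = Refinement (Grid (2 * k) n) (IsVC k n)

ConsecutiveSumsAtLeast : ℕ → List ℕ → Set
ConsecutiveSumsAtLeast k []            = ⊤
ConsecutiveSumsAtLeast k (x ∷ [])      = ⊤
ConsecutiveSumsAtLeast k (x ∷ y ∷ xs)  = (k ≤ x + y) × ConsecutiveSumsAtLeast k (y ∷ xs)

IsTComp : ℕ → ℕ → List ℕ → Set
IsTComp N k p =
  (sum p ≡ N)
  × All (λ a → (1 ≤ a) × (a ≤ k ∸ 1)) p
  × ConsecutiveSumsAtLeast k p

TComp : ℕ → ℕ → Set
TComp N k = Refinement (List ℕ) (IsTComp N k)

HasSize : Set → ℕ → Set
HasSize A m = A ↔ Fin m

-- The horizontal fault cuts the rectangle into two k × n strips. Inside a strip a horizontal tile at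
-- column x forces horizontal tiles at x on all k rows (a k × k block), and every column outside the
-- blocks is a single vertical tile, so a tiling is the set of columns where blocks start, each
-- labelled by its strip. A line x = c is no fault iff it runs through the interior of a block. Hence
-- the first block starts at 0, the last one ends at n, consecutive starts are 1 to k − 1 apart (so
-- their blocks lie in different strips), and starts two steps apart lie in the same strip and so are
-- at least k apart. The gaps between consecutive starts thus form a threshold composition of n − k,
-- which together with the strip of the first block determines the tiling.

{-# OPTIONS --safe #-}
module Submission where

open import Defs
open import Data.Nat
  using (ℕ; zero; suc; pred; _+_; _*_; _∸_; _≤_; _<_; z≤n; s≤s; s≤s⁻¹; z<s; >-nonZero; _≟_; _≤?_; _<?_)
open import Data.Nat.Properties
open import Data.Nat.Induction using (<-rec)
open import Data.Nat.ListAction using (sum)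
open import Algebra.Properties.CommutativeSemigroup +-commutativeSemigroup using (x∙yz≈y∙xz; xy∙z≈y∙xz)
open import Data.Fin using (Fin; toℕ; fromℕ<) renaming (suc to sucF)
open import Data.Fin.Patterns using (0F; 1F)
open import Data.Fin.Properties using (toℕ<n; toℕ-fromℕ<; fromℕ<-toℕ; toℕ-injective; any?; +↔⊎; *↔×)
open import Data.List using (List; []; _∷_)
import Data.List.Properties as List
open import Data.List.Relation.Unary.All using (All; []; _∷_)
open import Data.Maybe using (Maybe; just; nothing; fromMaybe)
import Data.Maybe.Properties as Maybe
open import Data.Vec using (lookup; tabulate)
import Data.Vec.Properties as Vec
open import Data.Product using (Σ; ∃; ∃₂; _×_; _,_; proj₁; proj₂)
open import Data.Product.Function.NonDependent.Propositional using (_×-↔_)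
open import Data.Sum using (_⊎_; inj₁; inj₂)
import Data.Sum as Sum
open import Data.Sum.Function.Propositional using (_⊎-↔_)
open import Data.Unit using (tt)
open import Data.Empty using (⊥; ⊥-elim; ⊥-elim-irr)
open import Data.Irrelevant using ([_])
open import Data.Refinement using (Refinement; _,_; value-injective)
open import Function using (_∘_; case_of_)
open import Function.Bundles using (_↔_; mk↔ₛ′)
open import Function.Properties.Inverse using (↔-trans; ↔-sym)
open import Relation.Nullary using (¬_; Dec; yes; no; contradiction; _×-dec_)
open import Relation.Nullary.Decidable using (map′; recompute)
open import Relation.Binary.Definitions using (DecidableEquality; tri<; tri≈; tri>)
open import Relation.Binary.PropositionalEquality
  using (_≡_; _≢_; refl; sym; trans; cong; cong₂; subst; module ≡-Reasoning)

Finite : Set → Set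
Finite A = ∃ (HasSize A)

finite-↔ : ∀ {A B} → A ↔ B → Finite B → Finite A
finite-↔ A↔B (m , B↔m) = m , ↔-trans A↔B B↔m

finite-⊎ : ∀ {A B} → Finite A → Finite B → Finite (A ⊎ B)
finite-⊎ (a , A↔a) (b , B↔b) = a + b , ↔-trans (A↔a ⊎-↔ B↔b) (↔-sym +↔⊎)

finite-¬ : ∀ {A} → ¬ A → Finite A
finite-¬ ¬a = 0 , mk↔ₛ′ (⊥-elim ∘ ¬a) (λ ()) (λ ()) (⊥-elim ∘ ¬a)

Σ-Fin-suc↔ : ∀ {m} (P : Fin (suc m) → Set) → Σ (Fin (suc m)) P ↔ (P 0F ⊎ Σ (Fin m) (P ∘ sucF))
Σ-Fin-suc↔ P = mk↔ₛ′ to from to∘from from∘to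
  where
  to : Σ _ P → P 0F ⊎ Σ _ (P ∘ sucF)
  to (0F , x) = inj₁ x
  to (sucF i , x) = inj₂ (i , x)
  from : P 0F ⊎ Σ _ (P ∘ sucF) → Σ _ P
  from (inj₁ x) = 0F , x
  from (inj₂ (i , x)) = sucF i , x
  to∘from : ∀ y → to (from y) ≡ y
  to∘from (inj₁ _) = refl
  to∘from (inj₂ _) = refl
  from∘to : ∀ x → from (to x) ≡ x
  from∘to (0F , _) = refl
  from∘to (sucF _ , _) = refl

finite-Σ-Fin : ∀ m {P : Fin m → Set} → (∀ i → Finite (P i)) → Finite (Σ (Fin m) P)
finite-Σ-Fin zero    _   = finite-¬ λ ()
finite-Σ-Fin (suc m) fin = finite-↔ (Σ-Fin-suc↔ _) (finite-⊎ (fin 0F) (finite-Σ-Fin m (fin ∘ sucF)))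

module ThresholdCompositions (k : ℕ) where

  Part : ℕ → Set
  Part a = 1 ≤ a × a ≤ k ∸ 1

  IsTCompAfter : ℕ → ℕ → List ℕ → Set
  IsTCompAfter d N p = sum p ≡ N × All Part p × ConsecutiveSumsAtLeast k (d ∷ p)

  TCompAfter : ℕ → ℕ → Set
  TCompAfter d N = Refinement (List ℕ) (IsTCompAfter d N)

  consecutiveSums-tail : ∀ d p → ConsecutiveSumsAtLeast k (d ∷ p) → ConsecutiveSumsAtLeast k p
  consecutiveSums-tail d []      _       = tt
  consecutiveSums-tail d (_ ∷ _) (_ , r) = r

  consecutiveSums-after-k : ∀ p → ConsecutiveSumsAtLeast k p → ConsecutiveSumsAtLeast k (k ∷ p)
  consecutiveSums-after-k []      _ = tt
  consecutiveSums-after-k (a ∷ _) r = m≤m+n k a , r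

  isTComp⇒isTCompAfter-k : ∀ {N p} → IsTComp N k p → IsTCompAfter k N p
  isTComp⇒isTCompAfter-k {p = p} (sp , ps , cs) = sp , ps , consecutiveSums-after-k p cs

  isTCompAfter⇒isTComp : ∀ {d N p} → IsTCompAfter d N p → IsTComp N k p
  isTCompAfter⇒isTComp {d} {p = p} (sp , ps , cs) = sp , ps , consecutiveSums-tail d p cs

  TComp↔TCompAfter-k : ∀ N → TComp N k ↔ TCompAfter k N
  TComp↔TCompAfter-k N = mk↔ₛ′
    (λ { (p , [ tc ]) → p , [ isTComp⇒isTCompAfter-k tc ] })
    (λ { (p , [ tc ]) → p , [ isTCompAfter⇒isTComp tc ] })
    (λ _ → refl) (λ _ → refl)

  CanFollow : ℕ → ℕ → Set
  CanFollow d e = Part e × k ≤ d + e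

  canFollow? : ∀ d e → Dec (CanFollow d e)
  canFollow? d e = ((1 ≤? e) ×-dec (e ≤? k ∸ 1)) ×-dec (k ≤? d + e)

  -- the tails q for which e ∷ q is in TCompAfter d N
  WithFirstPart : ℕ → ℕ → ℕ → Set
  WithFirstPart d N e = Refinement (List ℕ) (λ q → CanFollow d e × IsTCompAfter e (N ∸ e) q)

  TCompAfter-zero : ∀ d → HasSize (TCompAfter d 0) 1
  TCompAfter-zero d =
    mk↔ₛ′ (λ _ → 0F) (λ _ → [] , [ refl , [] , tt ]) (λ { 0F → refl ; (sucF ()) }) only-nil
    where
    is-nil : ∀ p → IsTCompAfter d 0 p → [] ≡ p
    is-nil []          _                      = refl
    is-nil (zero ∷ _)  (_ , (() , _) ∷ _ , _)
    is-nil (suc _ ∷ _) (() , _)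
    only-nil : ∀ (p : TCompAfter d 0) → ([] , [ refl , [] , tt ]) ≡ p
    only-nil (p , [ tc ]) = value-injective (recompute (List.≡-dec _≟_ [] p) (is-nil p tc))

  -- indexed by the value of the first part (the summand for 0 is empty)
  TCompAfter↔Σ-first : ∀ d N →
                       TCompAfter d (suc N) ↔ Σ (Fin (suc (suc N))) (WithFirstPart d (suc N) ∘ toℕ)
  TCompAfter↔Σ-first d N = mk↔ₛ′ to from to∘from from∘to
    where
    first< : ∀ {e q} → IsTCompAfter d (suc N) (e ∷ q) → e < suc (suc N)
    first< {e} {q} (sum≡ , _) = s≤s (subst (e ≤_) sum≡ (m≤m+n e (sum q)))
    split : ∀ {e q} → IsTCompAfter d (suc N) (e ∷ q) → CanFollow d e × IsTCompAfter e (suc N ∸ e) q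
    split {e} {q} (sum≡ , part ∷ parts , d+e≥k , sums) =
      (part , d+e≥k) , trans (sym (m+n∸m≡n e (sum q))) (cong (_∸ e) sum≡) , parts , sums
    join : ∀ (i : Fin (suc (suc N))) {q} → CanFollow d (toℕ i) × IsTCompAfter (toℕ i) (suc N ∸ toℕ i) q →
           IsTCompAfter d (suc N) (toℕ i ∷ q)
    join i ((part , d+e≥k) , sum≡ , parts , sums) =
      trans (cong (toℕ i +_) sum≡) (m+[n∸m]≡n (s≤s⁻¹ (toℕ<n i))) , part ∷ parts , d+e≥k , sums
    to : TCompAfter d (suc N) → Σ _ (WithFirstPart d (suc N) ∘ toℕ)
    to ([] , [ tc ]) = ⊥-elim-irr (0≢1+n (proj₁ tc))
    to (e ∷ q , [ tc ]) = fromℕ< e< , q , [ subst (λ e → CanFollow d e × IsTCompAfter e (suc N ∸ e) q)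
                                               (sym (toℕ-fromℕ< e<)) (split tc) ]
      where e< = recompute (e <? suc (suc N)) (first< tc)
    from : Σ _ (WithFirstPart d (suc N) ∘ toℕ) → TCompAfter d (suc N)
    from (i , q , [ tc ]) = toℕ i ∷ q , [ join i tc ]
    to∘from : ∀ y → to (from y) ≡ y
    to∘from (i , q , [ _ ]) = same-tail (fromℕ<-toℕ i _)
      where
      same-tail : ∀ {j} → j ≡ i → .{tc : _} .{tc′ : _} →
                  _≡_ {A = Σ _ (WithFirstPart d (suc N) ∘ toℕ)} (j , q , [ tc ]) (i , q , [ tc′ ])
      same-tail refl = refl
    from∘to : ∀ x → from (to x) ≡ x
    from∘to ([] , [ tc ]) = ⊥-elim-irr (0≢1+n (proj₁ tc))
    from∘to (e ∷ q , [ _ ]) = value-injective (cong (_∷ q) (toℕ-fromℕ< _))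

  WithFirstPart↔TCompAfter : ∀ {d N e} → CanFollow d e → WithFirstPart d N e ↔ TCompAfter e (N ∸ e)
  WithFirstPart↔TCompAfter d-e =
    mk↔ₛ′ (λ { (q , [ tc ]) → q , [ proj₂ tc ] }) (λ { (q , [ tc ]) → q , [ d-e , tc ] })
          (λ { (_ , [ _ ]) → refl }) (λ { (_ , [ _ ]) → refl })

  finite-WithFirstPart : ∀ d N e → (CanFollow d e → Finite (TCompAfter e (N ∸ e))) →
                         Finite (WithFirstPart d N e)
  finite-WithFirstPart d N e fin with canFollow? d e
  ... | yes d-e = finite-↔ (WithFirstPart↔TCompAfter d-e) (fin d-e)
  ... | no ¬d-e = finite-¬ λ { (_ , [ tc ]) → ⊥-elim-irr (¬d-e (proj₁ tc)) }

  finite-TCompAfter : ∀ N d → Finite (TCompAfter d N)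
  finite-TCompAfter = <-rec _ step
    where
    step : ∀ N → (∀ {M} → M < N → ∀ d → Finite (TCompAfter d M)) → ∀ d → Finite (TCompAfter d N)
    step zero    _        d = 1 , TCompAfter-zero d
    step (suc N) finite<N d = finite-↔ (TCompAfter↔Σ-first d N) (finite-Σ-Fin (suc (suc N)) λ i →
      finite-WithFirstPart d (suc N) (toℕ i) λ { ((1≤e , _) , _) →
        finite<N (∸-monoʳ-< 1≤e (s≤s⁻¹ (toℕ<n i))) (toℕ i) })

finite-TComp : ∀ N k → Finite (TComp N k)
finite-TComp N k = finite-↔ (TComp↔TCompAfter-k N) (finite-TCompAfter N k)
  where open ThresholdCompositions k

Plane : Set
Plane = ℕ → ℕ → Mark

toFin : ∀ {x w} → x < w → ∃ λ (X : Fin w) → toℕ X ≡ x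
toFin x<w = fromℕ< x<w , toℕ-fromℕ< x<w

module _ {h w : ℕ} where

  -- outside the rectangle the plane reads `none`
  markAt : Grid h w → Plane
  markAt g x y with x <? w | y <? h
  ... | yes x<w | yes y<h = mark g (fromℕ< x<w) (fromℕ< y<h)
  ... | _       | _       = none

  markAt-toℕ : ∀ g (X : Fin w) (Y : Fin h) → markAt g (toℕ X) (toℕ Y) ≡ mark g X Y
  markAt-toℕ g X Y with toℕ X <? w | toℕ Y <? h
  ... | yes p | yes q = cong₂ (mark g) (fromℕ<-toℕ X p) (fromℕ<-toℕ Y q)
  ... | no ¬p | _     = contradiction (toℕ<n X) ¬p
  ... | yes _ | no ¬q = contradiction (toℕ<n Y) ¬q

  tabulateGrid : Plane → Grid h w
  tabulateGrid F = tabulate λ X → tabulate λ Y → F (toℕ X) (toℕ Y)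

  mark-tabulateGrid : ∀ F X Y → mark (tabulateGrid F) X Y ≡ F (toℕ X) (toℕ Y)
  mark-tabulateGrid F X Y =
    trans (cong (λ column → lookup column Y) (Vec.lookup∘tabulate _ X)) (Vec.lookup∘tabulate _ Y)

  markAt-tabulateGrid : ∀ F {x y} → x < w → y < h → markAt (tabulateGrid F) x y ≡ F x y
  markAt-tabulateGrid F x<w y<h with toFin x<w | toFin y<h
  ... | X , refl | Y , refl = trans (markAt-toℕ _ X Y) (mark-tabulateGrid F X Y)

  tabulateGrid-markAt : ∀ g → tabulateGrid (markAt g) ≡ g
  tabulateGrid-markAt g = trans
    (Vec.tabulate-cong λ X → trans (Vec.tabulate-cong (markAt-toℕ g X)) (Vec.tabulate∘lookup (lookup g X)))
    (Vec.tabulate∘lookup g)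

  tabulateGrid-cong : ∀ {F G} → (∀ {x y} → x < w → y < h → F x y ≡ G x y) →
                      tabulateGrid F ≡ tabulateGrid G
  tabulateGrid-cong F≗G = Vec.tabulate-cong λ X → Vec.tabulate-cong λ Y → F≗G (toℕ<n X) (toℕ<n Y)

_≟ᴹ_ : DecidableEquality Mark
none  ≟ᴹ none  = yes refl
none  ≟ᴹ horiz = no λ ()
none  ≟ᴹ vert  = no λ ()
horiz ≟ᴹ none  = no λ ()
horiz ≟ᴹ horiz = yes refl
horiz ≟ᴹ vert  = no λ ()
vert  ≟ᴹ none  = no λ ()
vert  ≟ᴹ horiz = no λ ()
vert  ≟ᴹ vert  = yes refl

_≟ᴳ_ : ∀ {h w} → DecidableEquality (Grid h w)
_≟ᴳ_ = Vec.≡-dec (Vec.≡-dec _≟ᴹ_)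

record IsTilingℕ (h w k : ℕ) (F : Plane) : Set where
  field
    inBounds    : ∀ {x y} → x < w → y < h → InBounds h w k (F x y) x y
    covered     : ∀ {a b} → a < w → b < h → ∃₂ λ x y → x < w × y < h × Covers k (F x y) x y a b
    coveredOnce : ∀ {a b x y x′ y′} → a < w → b < h → x < w → y < h → x′ < w → y′ < h →
                  Covers k (F x y) x y a b → Covers k (F x′ y′) x′ y′ a b → x ≡ x′ × y ≡ y′

Crossed : (h w k : ℕ) → Plane → ℕ → Set
Crossed h w k F c = ∃₂ λ x y → x < w × y < h × MeetsVLine k (F x y) x y c

meetsVLine? : ∀ k m i j c → Dec (MeetsVLine k m i j c)
meetsVLine? k none  i j c = no λ ()
meetsVLine? k horiz i j c = (i <? c) ×-dec (c <? i + k)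
meetsVLine? k vert  i j c = (i <? c) ×-dec (c <? i + 1)

module _ {h w k : ℕ} where

  isTiling⇒isTilingℕ : ∀ {g} → IsTiling h w k g → IsTilingℕ h w k (markAt g)
  isTiling⇒isTilingℕ {g} (inb , cov) = record
    { inBounds = inBounds ; covered = covered ; coveredOnce = coveredOnce }
    where
    inBounds : ∀ {x y} → x < w → y < h → InBounds h w k (markAt g x y) x y
    inBounds x<w y<h with toFin x<w | toFin y<h
    ... | X , refl | Y , refl rewrite markAt-toℕ g X Y = inb X Y
    covered : ∀ {a b} → a < w → b < h → ∃₂ λ x y → x < w × y < h × Covers k (markAt g x y) x y a b
    covered a<w b<h with toFin a<w | toFin b<h
    ... | A , refl | B , refl with cov A B
    ...   | (X , Y) , XY-covers , _ = toℕ X , toℕ Y , toℕ<n X , toℕ<n Y ,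
            subst (λ m → Covers k m _ _ _ _) (sym (markAt-toℕ g X Y)) XY-covers
    coveredOnce : ∀ {a b x y x′ y′} → a < w → b < h → x < w → y < h → x′ < w → y′ < h →
                  Covers k (markAt g x y) x y a b → Covers k (markAt g x′ y′) x′ y′ a b →
                  x ≡ x′ × y ≡ y′
    coveredOnce a<w b<h x<w y<h x′<w y′<h c c′
      with toFin a<w | toFin b<h | toFin x<w | toFin y<h | toFin x′<w | toFin y′<h
    ... | A , refl | B , refl | X , refl | Y , refl | X′ , refl | Y′ , refl with cov A B
    ...   | _ , _ , once
            with once X Y (subst (λ m → Covers k m _ _ _ _) (markAt-toℕ g X Y) c)
               | once X′ Y′ (subst (λ m → Covers k m _ _ _ _) (markAt-toℕ g X′ Y′) c′)
    ...     | refl , refl | refl , refl = refl , refl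

  isTilingℕ⇒isTiling : ∀ {F} → IsTilingℕ h w k F → IsTiling h w k (tabulateGrid F)
  isTilingℕ⇒isTiling {F} T = inb , cov
    where
    open IsTilingℕ T
    inb : ∀ X Y → InBounds h w k (mark (tabulateGrid F) X Y) (toℕ X) (toℕ Y)
    inb X Y rewrite mark-tabulateGrid F X Y = inBounds (toℕ<n X) (toℕ<n Y)
    cov : ∀ (A : Fin w) (B : Fin h) → Σ (Fin w × Fin h) λ { (X , Y) →
            Covers k (mark (tabulateGrid F) X Y) (toℕ X) (toℕ Y) (toℕ A) (toℕ B)
            × (∀ X′ Y′ → Covers k (mark (tabulateGrid F) X′ Y′) (toℕ X′) (toℕ Y′) (toℕ A) (toℕ B) →
                 X′ ≡ X × Y′ ≡ Y) }
    cov A B with covered (toℕ<n A) (toℕ<n B)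
    ... | x , y , x<w , y<h , xy-covers with toFin x<w | toFin y<h
    ...   | X , refl | Y , refl =
            (X , Y) , subst (λ m → Covers k m _ _ _ _) (sym (mark-tabulateGrid F X Y)) xy-covers , once
      where
      once : ∀ X′ Y′ → Covers k (mark (tabulateGrid F) X′ Y′) (toℕ X′) (toℕ Y′) (toℕ A) (toℕ B) →
             X′ ≡ X × Y′ ≡ Y
      once X′ Y′ c′ with coveredOnce (toℕ<n A) (toℕ<n B) (toℕ<n X′) (toℕ<n Y′) x<w y<h
                           (subst (λ m → Covers k m _ _ _ _) (mark-tabulateGrid F X′ Y′) c′) xy-covers
      ... | x≡ , y≡ = toℕ-injective x≡ , toℕ-injective y≡

  horizontalFault⇒ℕ : ∀ {g c} → HorizontalFault k g c →
                      ∀ {x y} → x < w → y < h → ¬ MeetsHLine k (markAt g x y) x y c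
  horizontalFault⇒ℕ {g} fault x<w y<h with toFin x<w | toFin y<h
  ... | X , refl | Y , refl rewrite markAt-toℕ g X Y = fault X Y

  horizontalFaultℕ⇒ : ∀ {F c} → (∀ {x y} → x < w → y < h → ¬ MeetsHLine k (F x y) x y c) →
                      HorizontalFault k (tabulateGrid {h} {w} F) c
  horizontalFaultℕ⇒ {F} fault X Y rewrite mark-tabulateGrid F X Y = fault (toℕ<n X) (toℕ<n Y)

  noVerticalFault⇒crossed : ∀ {g c} → ¬ VerticalFault k g c → Crossed h w k (markAt g) c
  noVerticalFault⇒crossed {g} {c} ¬fault
    with any? (λ X → any? λ Y → meetsVLine? k (mark g X Y) (toℕ X) (toℕ Y) c)
  ... | yes (X , Y , meets) = toℕ X , toℕ Y , toℕ<n X , toℕ<n Y ,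
                              subst (λ m → MeetsVLine k m (toℕ X) (toℕ Y) c) (sym (markAt-toℕ g X Y)) meets
  ... | no ¬meets = contradiction (λ X Y meets → ¬meets (X , Y , meets)) ¬fault

  crossed⇒noVerticalFault : ∀ {F c} → Crossed h w k F c → ¬ VerticalFault k (tabulateGrid {h} {w} F) c
  crossed⇒noVerticalFault {F} {c} (x , y , x<w , y<h , meets) fault with toFin x<w | toFin y<h
  ... | X , refl | Y , refl =
    fault X Y (subst (λ m → MeetsVLine k m (toℕ X) (toℕ Y) c) (sym (mark-tabulateGrid F X Y)) meets)

record IsVCℕ (k n : ℕ) (F : Plane) : Set where
  field
    tiling  : IsTilingℕ (2 * k) n k F
    fault   : ∀ {x y} → x < n → y < 2 * k → ¬ MeetsHLine k (F x y) x y k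
    crossed : ∀ {c} → 0 < c → c < n → Crossed (2 * k) n k F c
  open IsTilingℕ tiling public

isVC⇒isVCℕ : ∀ {k n g} → IsVC k n g → IsVCℕ k n (markAt g)
isVC⇒isVCℕ (tiling , fault , noVerticalFault) = record
  { tiling  = isTiling⇒isTilingℕ tiling
  ; fault   = horizontalFault⇒ℕ fault
  ; crossed = λ 0<c c<n → noVerticalFault⇒crossed (noVerticalFault _ 0<c c<n)
  }

isVCℕ⇒isVC : ∀ {k n F} → IsVCℕ k n F → IsVC k n (tabulateGrid F)
isVCℕ⇒isVC V = isTilingℕ⇒isTiling tiling , horizontalFaultℕ⇒ fault ,
               λ _ 0<c c<n → crossed⇒noVerticalFault (crossed 0<c c<n)
  where open IsVCℕ V

data Strip : Set where
  bottom top : Strip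

other : Strip → Strip
other bottom = top
other top    = bottom

_≟ₛ_ : DecidableEquality Strip
bottom ≟ₛ bottom = yes refl
bottom ≟ₛ top    = no λ ()
top    ≟ₛ bottom = no λ ()
top    ≟ₛ top    = yes refl

Strip↔Fin2 : Strip ↔ Fin 2
Strip↔Fin2 = mk↔ₛ′ to from (λ { 0F → refl ; 1F → refl }) λ { bottom → refl ; top → refl }
  where
  to : Strip → Fin 2
  to bottom = 0F
  to top    = 1F
  from : Fin 2 → Strip
  from 0F = bottom
  from 1F = top

module Strips {k : ℕ} (0<k : 0 < k) where

  base : Strip → ℕ
  base bottom = 0
  base top    = k

  InStrip : Strip → ℕ → Set
  InStrip s y = base s ≤ y × y < base s + k

  base+k≤2k : ∀ s → base s + k ≤ 2 * k
  base+k≤2k bottom = m≤m+n k (k + 0)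
  base+k≤2k top    = ≤-reflexive (cong (k +_) (sym (+-identityʳ k)))

  inStrip⇒<2k : ∀ {s y} → InStrip s y → y < 2 * k
  inStrip⇒<2k {s} (_ , y<) = <-≤-trans y< (base+k≤2k s)

  base-inStrip : ∀ s → InStrip s (base s)
  base-inStrip s = ≤-refl , m<m+n (base s) 0<k

  base<2k : ∀ s → base s < 2 * k
  base<2k s = inStrip⇒<2k (base-inStrip s)

  inStrip-unique : ∀ {s s′ y} → InStrip s y → InStrip s′ y → s ≡ s′
  inStrip-unique {bottom} {bottom} _        _        = refl
  inStrip-unique {top}    {top}    _        _        = refl
  inStrip-unique {bottom} {top}    (_ , y<) (k≤ , _) = contradiction y< (≤⇒≯ k≤)
  inStrip-unique {top}    {bottom} (k≤ , _) (_ , y<) = contradiction y< (≤⇒≯ k≤)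

  stripOf : ℕ → Strip
  stripOf y with y <? k
  ... | yes _ = bottom
  ... | no  _ = top

  stripOf-inStrip : ∀ {y} → y < 2 * k → InStrip (stripOf y) y
  stripOf-inStrip {y} y<2k with y <? k
  ... | yes y<k = z≤n , y<k
  ... | no  y≮k = ≮⇒≥ y≮k , subst (y <_) (cong (k +_) (+-identityʳ k)) y<2k

  stripOf-unique : ∀ {s y} → InStrip s y → stripOf y ≡ s
  stripOf-unique sy = inStrip-unique (stripOf-inStrip (inStrip⇒<2k sy)) sy

module Stacking {k n : ℕ} (0<k : 0 < k) {F : Plane} (V : IsVCℕ k n F) where
  open Strips 0<k
  open IsVCℕ V

  vertical-at-base : ∀ {x y} → x < n → y < 2 * k → F x y ≡ vert → ∃ λ s → y ≡ base s
  vertical-at-base {x} {y} x<n y<2k Fxy≡vert = at-base y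
    (proj₂ (subst (λ m → InBounds (2 * k) n k m x y) Fxy≡vert (inBounds x<n y<2k)))
    (subst (λ m → ¬ MeetsHLine k m x y k) Fxy≡vert (fault x<n y<2k))
    where
    at-base : ∀ y → y + k ≤ 2 * k → ¬ (y < k × k < y + k) → ∃ λ s → y ≡ base s
    at-base zero    _      _       = bottom , refl
    at-base (suc y) y+k≤2k ¬meets with suc y <? k
    ... | yes y<k = contradiction (y<k , m<n+m k z<s) ¬meets
    ... | no  y≮k = top , ≤-antisym
      (+-cancelʳ-≤ k (suc y) k (subst (suc y + k ≤_) (cong (k +_) (+-identityʳ k)) y+k≤2k)) (≮⇒≥ y≮k)

  vertical-base : ∀ {x y s b} → x < n → y < 2 * k → F x y ≡ vert → y ≤ b → b < y + k → InStrip s b →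
                  y ≡ base s
  vertical-base x<n y<2k Fxy≡vert y≤b b<y+k sb with vertical-at-base x<n y<2k Fxy≡vert
  ... | _ , refl = cong base (inStrip-unique (y≤b , b<y+k) sb)

  horizontal-covers : ∀ {i b a} → F i b ≡ horiz → i ≤ a → a < i + k → Covers k (F i b) i b a b
  horizontal-covers Fib≡horiz i≤a a<i+k =
    subst (λ m → Covers k m _ _ _ _) (sym Fib≡horiz) (refl , i≤a , a<i+k)

  horizontal-overlap : ∀ {r i i′} → r < 2 * k → i′ < n → F i r ≡ horiz → F i′ r ≡ horiz →
                       i < i′ → i′ < i + k → ⊥
  horizontal-overlap r<2k i′<n Fir Fi′r i<i′ i′<i+k = <⇒≢ i<i′ (proj₁
    (coveredOnce i′<n r<2k (<-trans i<i′ i′<n) r<2k i′<n r<2k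
      (horizontal-covers Fir (<⇒≤ i<i′) i′<i+k) (horizontal-covers Fi′r ≤-refl (m<m+n _ 0<k))))

  -- the cell (i, b′) is covered neither by a vertical tile (it would also cover (i, b)) nor by a
  -- horizontal tile starting left of i (by induction it would overlap the tile at (i, b))
  stack : ∀ i {s b b′} → InStrip s b → InStrip s b′ → i < n → F i b ≡ horiz → F i b′ ≡ horiz
  stack = <-rec _ step
    where
    step : ∀ i →
           (∀ {p} → p < i → ∀ {s b b′} → InStrip s b → InStrip s b′ → p < n → F p b ≡ horiz → F p b′ ≡ horiz) →
           ∀ {s b b′} → InStrip s b → InStrip s b′ → i < n → F i b ≡ horiz → F i b′ ≡ horiz
    step i stack< {b = b} {b′} sb sb′ i<n Fib with covered i<n (inStrip⇒<2k sb′)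
    ... | p , q , p<n , q<2k , covers = by-coverer (F p q) refl covers
      where
      b<2k = inStrip⇒<2k sb
      Fib-covers = horizontal-covers Fib ≤-refl (m<m+n i 0<k)
      by-coverer : ∀ m → F p q ≡ m → Covers k m p q i b′ → F i b′ ≡ horiz
      by-coverer horiz Fpq (refl , p≤i , i<p+k) with m≤n⇒m<n∨m≡n p≤i
      ... | inj₂ refl = Fpq
      ... | inj₁ p<i = contradiction (proj₁ (coveredOnce i<n b<2k p<n b<2k i<n b<2k
                         (horizontal-covers (stack< p<i sb′ sb p<n Fpq) p≤i i<p+k) Fib-covers)) (<⇒≢ p<i)
      by-coverer vert Fpq (refl , q≤b′ , b′<q+k) = case trans (sym Fpq) (trans (cong (F i) q≡b) Fib) of λ ()
        where
        q≡base = vertical-base p<n q<2k Fpq q≤b′ b′<q+k sb′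
        covers-b : Covers k (F i q) i q i b
        covers-b = subst (λ m → Covers k m i q i b) (sym Fpq)
          (refl , subst (_≤ b) (sym q≡base) (proj₁ sb) , subst (λ z → b < z + k) (sym q≡base) (proj₂ sb))
        q≡b = proj₂ (coveredOnce i<n b<2k i<n q<2k i<n b<2k covers-b Fib-covers)

  Block : Strip → ℕ → Set
  Block s i = i < n × F i (base s) ≡ horiz

  crossed-by-block : ∀ {c} → 0 < c → c < n → ∃₂ λ i s → Block s i × i < c × c < i + k
  crossed-by-block {c} 0<c c<n with crossed 0<c c<n
  ... | x , y , x<n , y<2k , meets = by-crosser (F x y) refl meets
    where
    by-crosser : ∀ m → F x y ≡ m → MeetsVLine k m x y c → ∃₂ λ i s → Block s i × i < c × c < i + k
    by-crosser horiz Fxy (x<c , c<x+k) = x , stripOf y ,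
      (x<n , stack x (stripOf-inStrip y<2k) (base-inStrip _) x<n Fxy) , x<c , c<x+k
    by-crosser vert _ (x<c , c<x+1) = contradiction (subst (c <_) (+-comm x 1) c<x+1) (≤⇒≯ x<c)

  blocks-overlap : ∀ {s i i′} → Block s i → Block s i′ → i < i′ → i′ < i + k → ⊥
  blocks-overlap {s} (_ , Fis) (i′<n , Fi′s) = horizontal-overlap (base<2k s) i′<n Fis Fi′s

  both-strips : ∀ {x} → Block bottom x → Block top x → ∀ s → Block s x
  both-strips b₀ _  bottom = b₀
  both-strips _  bₖ top    = bₖ

  -- the column x (or k, if x = 0) is crossed by a block overlapping one of the two blocks at x
  block-in-one-strip : k < n → ∀ {x} → Block bottom x → Block top x → ⊥
  block-in-one-strip k<n {zero} b₀ bₖ with crossed-by-block 0<k k<n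
  ... | i , s , bi , i<k , k<i+k = blocks-overlap (both-strips b₀ bₖ s) bi (+-cancelʳ-< k 0 i k<i+k) i<k
  block-in-one-strip k<n {suc x} b₀ bₖ with crossed-by-block z<s (proj₁ b₀)
  ... | i , s , bi , i<x , x<i+k = blocks-overlap bi (both-strips b₀ bₖ s) i<x x<i+k

-- τ x ≡ just s records a k × k block of horizontal tiles with lower-left corner (x, base s)
Pattern : Set
Pattern = ℕ → Maybe Strip

_≟ₘ_ : DecidableEquality (Maybe Strip)
_≟ₘ_ = Maybe.≡-dec _≟ₛ_

horizontal? : ∀ m → Dec (m ≡ horiz)
horizontal? none  = no λ ()
horizontal? horiz = yes refl
horizontal? vert  = no λ ()

module Patterns {k n : ℕ} (0<k : 0 < k) where
  open Strips 0<k

  record Admissible (τ : Pattern) : Set where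
    field
      fits    : ∀ {x s} → τ x ≡ just s → x + k ≤ n
      apart   : ∀ {x x′ s} → τ x ≡ just s → τ x′ ≡ just s → x < x′ → x + k ≤ x′
      crosses : ∀ {c} → 0 < c → c < n → ∃₂ λ x s → τ x ≡ just s × x < c × c < x + k

  InBlock : Pattern → Strip → ℕ → Set
  InBlock τ s x = ∃ λ x₀ → τ x₀ ≡ just s × x₀ ≤ x × x < x₀ + k

  inBlock? : ∀ τ s x → Dec (InBlock τ s x)
  inBlock? τ s x = map′
    (λ { (x₀ , x₀<1+x , τx₀ , x<) → x₀ , τx₀ , s≤s⁻¹ x₀<1+x , x< })
    (λ { (x₀ , τx₀ , x₀≤x , x<) → x₀ , s≤s x₀≤x , τx₀ , x< })
    (anyUpTo? (λ x₀ → (τ x₀ ≟ₘ just s) ×-dec (x <? x₀ + k)) (suc x))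

  -- columns of strip s outside every block carry a vertical tile on the base row
  tileAt : Pattern → Strip → ℕ → ℕ → Mark
  tileAt τ s x y with τ x ≟ₘ just s | y ≟ base s | inBlock? τ s x
  ... | yes _ | _     | _     = horiz
  ... | no _  | yes _ | no _  = vert
  ... | no _  | _     | _     = none

  data TileView (τ : Pattern) (s : Strip) (x y : ℕ) : Mark → Set where
    horizontal : τ x ≡ just s → TileView τ s x y horiz
    vertical   : τ x ≢ just s → y ≡ base s → ¬ InBlock τ s x → TileView τ s x y vert
    empty      : τ x ≢ just s → y ≢ base s ⊎ InBlock τ s x → TileView τ s x y none

  tileView : ∀ τ s x y → TileView τ s x y (tileAt τ s x y)
  tileView τ s x y with τ x ≟ₘ just s | y ≟ base s | inBlock? τ s x
  ... | yes τx | _     | _      = horizontal τx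
  ... | no ¬τx | yes y≡ | no ¬b = vertical ¬τx y≡ ¬b
  ... | no ¬τx | yes _ | yes b  = empty ¬τx (inj₂ b)
  ... | no ¬τx | no y≢ | _      = empty ¬τx (inj₁ y≢)

  tileView-unique : ∀ {τ s x y m} → TileView τ s x y m → tileAt τ s x y ≡ m
  tileView-unique {τ} {s} {x} {y} v with tileAt τ s x y | tileView τ s x y | v
  ... | _ | horizontal _      | horizontal _      = refl
  ... | _ | vertical _ _ _    | vertical _ _ _    = refl
  ... | _ | empty _ _         | empty _ _         = refl
  ... | _ | horizontal τx     | vertical ¬τx _ _  = contradiction τx ¬τx
  ... | _ | horizontal τx     | empty ¬τx _       = contradiction τx ¬τx
  ... | _ | vertical ¬τx _ _  | horizontal τx     = contradiction τx ¬τx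
  ... | _ | empty ¬τx _       | horizontal τx     = contradiction τx ¬τx
  ... | _ | vertical _ y≡ _   | empty _ (inj₁ y≢) = contradiction y≡ y≢
  ... | _ | vertical _ _ ¬b   | empty _ (inj₂ b)  = contradiction b ¬b
  ... | _ | empty _ (inj₁ y≢) | vertical _ y≡ _   = contradiction y≡ y≢
  ... | _ | empty _ (inj₂ b)  | vertical _ _ ¬b   = contradiction b ¬b

  tileAt-horiz : ∀ {τ s x y} → τ x ≡ just s → tileAt τ s x y ≡ horiz
  tileAt-horiz τx = tileView-unique (horizontal τx)

  tileAt-horiz⁻¹ : ∀ {τ s x y} → tileAt τ s x y ≡ horiz → τ x ≡ just s
  tileAt-horiz⁻¹ {τ} {s} {x} {y} eq with tileAt τ s x y | tileView τ s x y
  tileAt-horiz⁻¹ refl | _ | horizontal τx = τx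

  tileAt-vert : ∀ {τ s x} → ¬ InBlock τ s x → tileAt τ s x (base s) ≡ vert
  tileAt-vert {x = x} ¬b = tileView-unique (vertical (λ τx → ¬b (x , τx , ≤-refl , m<m+n x 0<k)) refl ¬b)

  InBlock-cong : ∀ {τ τ′ s x} → (∀ x → τ x ≡ τ′ x) → InBlock τ s x → InBlock τ′ s x
  InBlock-cong τ≗τ′ (x₀ , τx₀ , b) = x₀ , trans (sym (τ≗τ′ x₀)) τx₀ , b

  TileView-cong : ∀ {τ τ′ s x y m} → (∀ x → τ x ≡ τ′ x) →
                  TileView τ s x y m → TileView τ′ s x y m
  TileView-cong {x = x} τ≗τ′ (horizontal τx)     = horizontal (trans (sym (τ≗τ′ x)) τx)
  TileView-cong {x = x} τ≗τ′ (vertical ¬τx y≡ ¬b) =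
    vertical (¬τx ∘ trans (τ≗τ′ x)) y≡ (¬b ∘ InBlock-cong (sym ∘ τ≗τ′))
  TileView-cong {x = x} τ≗τ′ (empty ¬τx alt)      =
    empty (¬τx ∘ trans (τ≗τ′ x)) (Sum.map₂ (InBlock-cong τ≗τ′) alt)

  planeOf : Pattern → Plane
  planeOf τ x y = tileAt τ (stripOf y) x y

  planeOf-inStrip : ∀ τ {s x y} → InStrip s y → planeOf τ x y ≡ tileAt τ s x y
  planeOf-inStrip τ {x = x} {y} sy = cong (λ s → tileAt τ s x y) (stripOf-unique sy)

  planeOf-base : ∀ τ s x → planeOf τ x (base s) ≡ tileAt τ s x (base s)
  planeOf-base τ s x = planeOf-inStrip τ (base-inStrip s)

  planeOf-cong : ∀ {τ τ′} → (∀ x → τ x ≡ τ′ x) → ∀ x y → planeOf τ x y ≡ planeOf τ′ x y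
  planeOf-cong {τ} τ≗τ′ x y = sym (tileView-unique (TileView-cong τ≗τ′ (tileView τ (stripOf y) x y)))

  -- the strip of the block starting at a column, read off from its marks on the rows 0 and k
  blockStrip : Mark → Mark → Maybe Strip
  blockStrip m₀ mₖ with horizontal? m₀ | horizontal? mₖ
  ... | yes _ | _     = just bottom
  ... | no _  | yes _ = just top
  ... | no _  | no _  = nothing

  patternOf : Plane → Pattern
  patternOf F x with x <? n
  ... | yes _ = blockStrip (F x 0) (F x k)
  ... | no  _ = nothing

  patternOf-just : ∀ {F x s} → patternOf F x ≡ just s → x < n × F x (base s) ≡ horiz
  patternOf-just {F} {x} eq with x <? n
  ... | no _ = case eq of λ ()
  ... | yes x<n with horizontal? (F x 0) | horizontal? (F x k)
  ...   | yes h₀ | _      = x<n , subst (λ s → F x (base s) ≡ horiz) (Maybe.just-injective eq) h₀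
  ...   | no _   | yes hₖ = x<n , subst (λ s → F x (base s) ≡ horiz) (Maybe.just-injective eq) hₖ
  ...   | no _   | no _   = case eq of λ ()

  patternOf-spec : ∀ {F x r} → x < n → (∀ s → F x (base s) ≡ horiz → r ≡ just s) →
                   (∀ s → r ≡ just s → F x (base s) ≡ horiz) → patternOf F x ≡ r
  patternOf-spec {F} {x} {r} x<n to from with x <? n
  ... | no x≮n = contradiction x<n x≮n
  ... | yes _ with horizontal? (F x 0) | horizontal? (F x k)
  ...   | yes h₀ | _      = sym (to bottom h₀)
  ...   | no _   | yes hₖ = sym (to top hₖ)
  ...   | no ¬h₀ | no ¬hₖ with r
  ...     | nothing     = refl
  ...     | just bottom = contradiction (from bottom refl) ¬h₀
  ...     | just top    = contradiction (from top refl) ¬hₖ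

  patternOf-outside : ∀ {F x} → ¬ x < n → patternOf F x ≡ nothing
  patternOf-outside {x = x} x≮n with x <? n
  ... | yes x<n = contradiction x<n x≮n
  ... | no _    = refl

  patternOf-cong : ∀ {F G} → (∀ {x y} → x < n → y < 2 * k → F x y ≡ G x y) →
                   ∀ x → patternOf F x ≡ patternOf G x
  patternOf-cong F≗G x with x <? n
  ... | yes x<n = cong₂ blockStrip (F≗G x<n (base<2k bottom))
                                   (F≗G x<n (base<2k top))
  ... | no _    = refl

  module FromAdmissible {τ : Pattern} (A : Admissible τ) where
    open Admissible A

    same-block : ∀ {s x x′ a} → τ x ≡ just s → τ x′ ≡ just s →
                 x ≤ a → a < x + k → x′ ≤ a → a < x′ + k → x ≡ x′
    same-block {x = x} {x′} τx τx′ x≤a a<x+k x′≤a a<x′+k with <-cmp x x′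
    ... | tri< x<x′ _ _ = contradiction (≤-trans (apart τx τx′ x<x′) x′≤a) (<⇒≱ a<x+k)
    ... | tri≈ _ x≡x′ _ = x≡x′
    ... | tri> _ _ x′<x = contradiction (≤-trans (apart τx′ τx x′<x) x≤a) (<⇒≱ a<x′+k)

    inBounds : ∀ {a b} → a < n → b < 2 * k → InBounds (2 * k) n k (planeOf τ a b) a b
    inBounds {a} {b} a<n b<2k with planeOf τ a b | tileView τ (stripOf b) a b
    ... | _ | horizontal τa    = fits τa , subst (_≤ 2 * k) (+-comm 1 b) b<2k
    ... | _ | vertical _ b≡ _  =
      subst (_≤ n) (+-comm 1 a) a<n , subst (λ y → y + k ≤ 2 * k) (sym b≡) (base+k≤2k _)
    ... | _ | empty _ _        = tt

    covered : ∀ {a b} → a < n → b < 2 * k →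
              ∃₂ λ x y → x < n × y < 2 * k × Covers k (planeOf τ x y) x y a b
    covered {a} {b} a<n b<2k with inBlock? τ (stripOf b) a
    ... | yes (x₀ , τx₀ , x₀≤a , a<x₀+k) = x₀ , b , ≤-<-trans x₀≤a a<n , b<2k ,
          subst (λ m → Covers k m x₀ b a b) (sym (tileAt-horiz τx₀)) (refl , x₀≤a , a<x₀+k)
    ... | no ¬b = a , base s , a<n , base<2k s ,
          subst (λ m → Covers k m a (base s) a b) (sym (trans (planeOf-base τ s a) (tileAt-vert ¬b)))
                (refl , stripOf-inStrip b<2k)
      where s = stripOf b

    data Coverer (a b x y : ℕ) : Set where
      block  : τ x ≡ just (stripOf b) → y ≡ b → x ≤ a → a < x + k → Coverer a b x y
      column : x ≡ a → y ≡ base (stripOf b) → ¬ InBlock τ (stripOf b) a → Coverer a b x y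

    coverer : ∀ {a b x y} → Covers k (planeOf τ x y) x y a b → Coverer a b x y
    coverer {a} {b} {x} {y} covers with planeOf τ x y | tileView τ (stripOf y) x y
    coverer (refl , x≤a , a<x+k) | _ | horizontal τx = block τx refl x≤a a<x+k
    coverer {a} {b} {x} {y} (refl , y≤b , b<y+k) | _ | vertical _ y≡ ¬b =
      column refl (trans y≡ (cong base same-strip)) (subst (λ s → ¬ InBlock τ s x) same-strip ¬b)
      where
      same-strip : stripOf y ≡ stripOf b
      same-strip = sym (stripOf-unique (subst (_≤ b) y≡ y≤b , subst (λ y → b < y + k) y≡ b<y+k))

    coveredOnce : ∀ {a b x y x′ y′} → a < n → b < 2 * k → x < n → y < 2 * k → x′ < n → y′ < 2 * k →
                  Covers k (planeOf τ x y) x y a b → Covers k (planeOf τ x′ y′) x′ y′ a b →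
                  x ≡ x′ × y ≡ y′
    coveredOnce _ _ _ _ _ _ c c′ with coverer c | coverer c′
    ... | block τx y≡ x≤ <x+k | block τx′ y′≡ x′≤ <x′+k =
      same-block τx τx′ x≤ <x+k x′≤ <x′+k , trans y≡ (sym y′≡)
    ... | block τx _ x≤ <x+k  | column _ _ ¬b          = contradiction (_ , τx , x≤ , <x+k) ¬b
    ... | column _ _ ¬b       | block τx′ _ x′≤ <x′+k   = contradiction (_ , τx′ , x′≤ , <x′+k) ¬b
    ... | column x≡ y≡ _      | column x′≡ y′≡ _       = trans x≡ (sym x′≡) , trans y≡ (sym y′≡)

    fault : ∀ {x y} → x < n → y < 2 * k → ¬ MeetsHLine k (planeOf τ x y) x y k
    fault {x} {y} _ _ meets with planeOf τ x y | tileView τ (stripOf y) x y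
    fault {x} {y} _ _ (y<k , k<y+1) | _ | horizontal _ =
      contradiction (s≤s⁻¹ (subst (k <_) (+-comm y 1) k<y+1)) (<⇒≱ y<k)
    fault {x} {y} _ _ (y<k , k<y+k) | _ | vertical _ y≡ _ = not-across (stripOf y) y≡
      where
      not-across : ∀ s → y ≡ base s → ⊥
      not-across bottom refl = <-irrefl refl k<y+k
      not-across top    refl = <-irrefl refl y<k

    isVCℕ-planeOf : IsVCℕ k n (planeOf τ)
    isVCℕ-planeOf = record
      { tiling  = record { inBounds = inBounds ; covered = covered ; coveredOnce = coveredOnce }
      ; fault   = fault
      ; crossed = λ 0<c c<n → case crosses 0<c c<n of λ { (x , s , τx , x<c , c<x+k) →
                    x , base s , <-trans x<c c<n , base<2k s ,
                    subst (λ m → MeetsVLine k m x (base s) _) (sym (trans (planeOf-base τ s x) (tileAt-horiz τx)))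
                          (x<c , c<x+k) }
      }

    nothing-outside : ∀ {x} → ¬ x < n → τ x ≡ nothing
    nothing-outside {x} x≮n with τ x in τx
    ... | nothing = refl
    ... | just _  = contradiction (<-≤-trans (m<m+n x 0<k) (fits τx)) x≮n

    patternOf-planeOf : ∀ x → patternOf (planeOf τ) x ≡ τ x
    patternOf-planeOf x = case x <? n of λ
      { (yes x<n) → patternOf-spec x<n (λ s h → tileAt-horiz⁻¹ (trans (sym (planeOf-base τ s x)) h))
                                       (λ s τx → trans (planeOf-base τ s x) (tileAt-horiz τx))
      ; (no x≮n)  → trans (patternOf-outside x≮n) (sym (nothing-outside x≮n))
      }

  module FromTiling (k<n : k < n) {F : Plane} (V : IsVCℕ k n F) where
    open IsVCℕ V
    open Stacking 0<k V

    same-strip : ∀ {x} s s′ → Block s x → Block s′ x → s ≡ s′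
    same-strip bottom bottom _  _  = refl
    same-strip top    top    _  _  = refl
    same-strip bottom top    b₀ bₖ = contradiction bₖ (block-in-one-strip k<n b₀)
    same-strip top    bottom bₖ b₀ = contradiction bₖ (block-in-one-strip k<n b₀)

    block⇒patternOf : ∀ {s x} → Block s x → patternOf F x ≡ just s
    block⇒patternOf {s} block@(x<n , _) = patternOf-spec x<n
      (λ s′ h → cong just (same-strip s s′ block (x<n , h)))
      (λ s′ eq → subst (λ s → F _ (base s) ≡ horiz) (Maybe.just-injective eq) (proj₂ block))

    admissible-patternOf : Admissible (patternOf F)
    admissible-patternOf = record { fits = fits ; apart = apart ; crosses = crosses }
      where
      fits : ∀ {x s} → patternOf F x ≡ just s → x + k ≤ n
      fits {x} {s} τx with patternOf-just τx
      ... | x<n , h = proj₁ (subst (λ m → InBounds (2 * k) n k m x (base s)) h (inBounds x<n (base<2k s)))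
      apart : ∀ {x x′ s} → patternOf F x ≡ just s → patternOf F x′ ≡ just s → x < x′ → x + k ≤ x′
      apart τx τx′ x<x′ = ≮⇒≥ (blocks-overlap (patternOf-just τx) (patternOf-just τx′) x<x′)
      crosses : ∀ {c} → 0 < c → c < n → ∃₂ λ x s → patternOf F x ≡ just s × x < c × c < x + k
      crosses 0<c c<n with crossed-by-block 0<c c<n
      ... | i , s , block , i<c , c<i+k = i , s , block⇒patternOf block , i<c , c<i+k

    τ : Pattern
    τ = patternOf F

    column-vertical : ∀ {s x} → x < n → ¬ InBlock τ s x → F x (base s) ≡ vert
    column-vertical {s} {x} x<n ¬b with covered x<n (base<2k s)
    ... | p , q , p<n , q<2k , covers = by-coverer (F p q) refl covers
      where
      by-coverer : ∀ m → F p q ≡ m → Covers k m p q x (base s) → F x (base s) ≡ vert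
      by-coverer horiz Fpq (refl , p≤x , x<p+k) =
        contradiction (p , block⇒patternOf (p<n , Fpq) , p≤x , x<p+k) ¬b
      by-coverer vert  Fpq (refl , q≤ , <q+k) =
        subst (λ y → F x y ≡ vert) (vertical-base p<n q<2k Fpq q≤ <q+k (base-inStrip s)) Fpq

    not-horizontal : ∀ {s x y} → x < n → InStrip s y → τ x ≢ just s → F x y ≢ horiz
    not-horizontal x<n sy ¬τx Fxy = ¬τx (block⇒patternOf (x<n , stack _ sy (base-inStrip _) x<n Fxy))

    not-vertical : ∀ {s x y} → x < n → InStrip s y → τ x ≢ just s → y ≢ base s ⊎ InBlock τ s x →
                   F x y ≢ vert
    not-vertical {y = y} x<n sy _ (inj₁ y≢) Fxy = y≢ (vertical-base x<n y<2k Fxy ≤-refl (m<m+n y 0<k) sy)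
      where y<2k = inStrip⇒<2k sy
    not-vertical {s} {x} {y} x<n sy ¬τx (inj₂ (x₀ , τx₀ , x₀≤x , x<x₀+k)) Fxy
      with m≤n⇒m<n∨m≡n x₀≤x
    ... | inj₂ refl = ¬τx τx₀
    ... | inj₁ x₀<x = <⇒≢ x₀<x (proj₁ (coveredOnce x<n y<2k (<-trans x₀<x x<n) y<2k x<n y<2k
          (horizontal-covers (stack x₀ (base-inStrip s) sy (<-trans x₀<x x<n) (proj₂ (patternOf-just τx₀)))
                             x₀≤x x<x₀+k)
          (subst (λ m → Covers k m x y x y) (sym Fxy) (refl , ≤-refl , m<m+n y 0<k))))
      where y<2k = inStrip⇒<2k sy

    tileAt-patternOf : ∀ {s x y} → x < n → InStrip s y → F x y ≡ tileAt τ s x y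
    tileAt-patternOf {s} {x} {y} x<n sy with tileAt τ s x y | tileView τ s x y
    ... | _ | horizontal τx        = stack x (base-inStrip s) sy x<n (proj₂ (patternOf-just τx))
    ... | _ | vertical _ refl ¬b   = column-vertical x<n ¬b
    ... | _ | empty ¬τx alt with F x y in Fxy
    ...   | none  = refl
    ...   | horiz = contradiction Fxy (not-horizontal x<n sy ¬τx)
    ...   | vert  = contradiction Fxy (not-vertical x<n sy ¬τx alt)

    planeOf-patternOf : ∀ {x y} → x < n → y < 2 * k → F x y ≡ planeOf τ x y
    planeOf-patternOf x<n y<2k = tileAt-patternOf x<n (stripOf-inStrip y<2k)

module Compositions {k n : ℕ} (0<k : 0 < k) (k<n : k < n) where
  open Strips 0<k
  open Patterns {k} {n} 0<k
  open ThresholdCompositions k using (Part; consecutiveSums-tail)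

  N : ℕ
  N = n ∸ k

  N+k≡n : N + k ≡ n
  N+k≡n = m∸n+n≡m (<⇒≤ k<n)

  -- the blocks start at a and at the partial sums a + d₁ + ⋯ + dᵢ, alternating strips
  blocksFrom : Strip → ℕ → List ℕ → Pattern
  blocksFrom s a []      x with x ≟ a
  ... | yes _ = just s
  ... | no  _ = nothing
  blocksFrom s a (d ∷ p) x with x ≟ a
  ... | yes _ = just s
  ... | no  _ = blocksFrom (other s) (a + d) p x

  blocksFrom-start : ∀ s a p → blocksFrom s a p a ≡ just s
  blocksFrom-start s a []      with a ≟ a
  ... | yes _ = refl
  ... | no a≢a = contradiction refl a≢a
  blocksFrom-start s a (_ ∷ _) with a ≟ a
  ... | yes _ = refl
  ... | no a≢a = contradiction refl a≢a

  blocksFrom-[] : ∀ {s a x} → x ≢ a → blocksFrom s a [] x ≡ nothing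
  blocksFrom-[] {a = a} {x} x≢a with x ≟ a
  ... | yes x≡a = contradiction x≡a x≢a
  ... | no _    = refl

  blocksFrom-∷ : ∀ s a d p {x} → x ≢ a → blocksFrom s a (d ∷ p) x ≡ blocksFrom (other s) (a + d) p x
  blocksFrom-∷ s a d p {x} x≢a with x ≟ a
  ... | yes x≡a = contradiction x≡a x≢a
  ... | no _    = refl

  blocksFrom-below : ∀ s a p {x} → x < a → blocksFrom s a p x ≡ nothing
  blocksFrom-below s a []      x<a = blocksFrom-[] (<⇒≢ x<a)
  blocksFrom-below s a (d ∷ p) x<a =
    trans (blocksFrom-∷ s a d p (<⇒≢ x<a)) (blocksFrom-below (other s) (a + d) p (<-≤-trans x<a (m≤m+n a d)))

  blocksFrom-range : ∀ s a p {x t} → blocksFrom s a p x ≡ just t → a ≤ x × x ≤ a + sum p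
  blocksFrom-range s a []      {x} eq with x ≟ a
  ... | yes refl = ≤-refl , m≤m+n x 0
  blocksFrom-range s a (d ∷ p) {x} eq with x ≟ a
  ... | yes refl = ≤-refl , m≤m+n x (d + sum p)
  ... | no _ with blocksFrom-range (other s) (a + d) p eq
  ...   | a+d≤x , x≤ = ≤-trans (m≤m+n a d) a+d≤x , subst (x ≤_) (+-assoc a d (sum p)) x≤

  k∸1≡pred[k] : k ∸ 1 ≡ pred k
  k∸1≡pred[k] = sym (pred[m∸n]≡m∸[1+n] k 0)

  ≤k∸1⇒<k : ∀ {a} → a ≤ k ∸ 1 → a < k
  ≤k∸1⇒<k {a} a≤ = m≤pred[n]⇒suc[m]≤n {{>-nonZero 0<k}} (subst (a ≤_) k∸1≡pred[k] a≤)

  <k⇒≤k∸1 : ∀ {a} → a < k → a ≤ k ∸ 1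
  <k⇒≤k∸1 {a} a<k = subst (a ≤_) (sym k∸1≡pred[k]) (<⇒≤pred a<k)

  other-≢ : ∀ s → other s ≢ s
  other-≢ bottom ()
  other-≢ top    ()

  blocksFrom-apart : ∀ s a p → ConsecutiveSumsAtLeast k p → ∀ {x x′ t} →
                     blocksFrom s a p x ≡ just t → blocksFrom s a p x′ ≡ just t → x < x′ → x + k ≤ x′
  blocksFrom-apart s a [] _ {x} {x′} τx τx′ x<x′ with x ≟ a | x′ ≟ a
  ... | yes refl | yes refl = contradiction x<x′ (<-irrefl refl)
  blocksFrom-apart s a (d ∷ p) sums {x} {x′} τx τx′ x<x′ with x ≟ a
  ... | no x≢a = blocksFrom-apart (other s) (a + d) p (consecutiveSums-tail d p sums) τx
                   (trans (sym (blocksFrom-∷ s a d p (<⇒≢ (≤-<-trans a≤x x<x′) ∘ sym))) τx′) x<x′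
    where a≤x = proj₁ (blocksFrom-range s a (d ∷ p) (trans (blocksFrom-∷ s a d p x≢a) τx))
  ... | yes refl = next-in-same-strip p sums
                     (trans (sym (blocksFrom-∷ s x d p (<⇒≢ x<x′ ∘ sym))) (trans τx′ (sym τx)))
    where
    next-in-same-strip : ∀ p → ConsecutiveSumsAtLeast k (d ∷ p) →
                         blocksFrom (other s) (x + d) p x′ ≡ just s → x + k ≤ x′
    next-in-same-strip [] _ eq with x′ ≟ x + d
    ... | yes _ = contradiction (Maybe.just-injective eq) (other-≢ s)
    next-in-same-strip (e ∷ p) (k≤d+e , _) eq with x′ ≟ x + d
    ... | yes _ = contradiction (Maybe.just-injective eq) (other-≢ s)
    ... | no _ = ≤-trans (+-monoʳ-≤ x k≤d+e)
                   (subst (_≤ x′) (+-assoc x d e) (proj₁ (blocksFrom-range (other (other s)) (x + d + e) p eq)))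

  blocksFrom-crosses : ∀ s a p → All Part p → ∀ {c} → a < c → c < a + sum p + k →
                       ∃₂ λ x t → blocksFrom s a p x ≡ just t × x < c × c < x + k
  blocksFrom-crosses s a [] _ {c} a<c c< =
    a , s , blocksFrom-start s a [] , a<c , subst (λ z → c < z + k) (+-identityʳ a) c<
  blocksFrom-crosses s a (d ∷ p) ((1≤d , d≤k-1) ∷ parts) {c} a<c c< with c <? a + k
  ... | yes c<a+k = a , s , blocksFrom-start s a (d ∷ p) , a<c , c<a+k
  ... | no c≮a+k with blocksFrom-crosses (other s) (a + d) p parts a+d<c
                        (subst (λ z → c < z + k) (sym (+-assoc a d (sum p))) c<)
    where
    a+d<c : a + d < c
    a+d<c = <-≤-trans (+-monoʳ-< a (≤k∸1⇒<k d≤k-1)) (≮⇒≥ c≮a+k)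
  ... | x , t , τx , x<c , c<x+k = x , t , trans (blocksFrom-∷ s a d p x≢a) τx , x<c , c<x+k
    where
    x≢a : x ≢ a
    x≢a x≡a = <-irrefl (sym x≡a)
      (<-≤-trans (m<m+n a 1≤d) (proj₁ (blocksFrom-range (other s) (a + d) p τx)))

  admissible-blocksFrom : ∀ s {p} → IsTComp N k p → Admissible (blocksFrom s 0 p)
  admissible-blocksFrom s {p} (sum≡N , parts , sums) = record
    { fits    = λ {x} τx → subst (x + k ≤_) (trans (cong (_+ k) sum≡N) N+k≡n)
                                (+-monoˡ-≤ k (proj₂ (blocksFrom-range s 0 p τx)))
    ; apart   = blocksFrom-apart s 0 p sums
    ; crosses = λ {c} 0<c c<n → blocksFrom-crosses s 0 p parts 0<c
                                  (subst (c <_) (sym (trans (cong (_+ k) sum≡N) N+k≡n)) c<n)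
    }

  -- scanning right from the block start a: the c columns after a start no block, f columns remain
  gapsFrom : Pattern → ℕ → ℕ → ℕ → List ℕ
  gapsFrom τ a c zero    = []
  gapsFrom τ a c (suc f) with τ (a + suc c)
  ... | nothing = gapsFrom τ a (suc c) f
  ... | just _  = suc c ∷ gapsFrom τ (a + suc c) 0 f

  gaps : Pattern → List ℕ
  gaps τ = gapsFrom τ 0 0 N

  gapsFrom-cong : ∀ {τ τ′} f a c → (∀ {x} → a < x → τ x ≡ τ′ x) →
                  gapsFrom τ a c f ≡ gapsFrom τ′ a c f
  gapsFrom-cong zero a c τ≗τ′ = refl
  gapsFrom-cong {τ} {τ′} (suc f) a c τ≗τ′
    with τ (a + suc c) | τ′ (a + suc c) | τ≗τ′ {a + suc c} (m<m+n a z<s)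
  ... | nothing | nothing | refl = gapsFrom-cong f a (suc c) τ≗τ′
  ... | just _  | just _  | refl =
    cong (suc c ∷_) (gapsFrom-cong f (a + suc c) 0 (τ≗τ′ ∘ <-trans (m<m+n a z<s)))

  gapsFrom-jump : ∀ {τ a} c e f {t} → (∀ {x} → a + c < x → x < a + suc (c + e) → τ x ≡ nothing) →
                  τ (a + suc (c + e)) ≡ just t →
                  gapsFrom τ a c (suc (e + f)) ≡ suc (c + e) ∷ gapsFrom τ (a + suc (c + e)) 0 f
  gapsFrom-jump c zero f free τnext rewrite +-identityʳ c | τnext = refl
  gapsFrom-jump {a = a} c (suc e) f free τnext
    rewrite free {a + suc c} (+-monoʳ-< a (n<1+n c)) (+-monoʳ-< a (s≤s (m<m+n c z<s)))
          | +-suc c e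
    = gapsFrom-jump (suc c) e f
        (λ a+1+c<x x< → free (<-trans (+-monoʳ-< a (n<1+n c)) a+1+c<x) x<) τnext

  gaps-blocksFrom : ∀ s a p → All Part p → gapsFrom (blocksFrom s a p) a 0 (sum p) ≡ p
  gaps-blocksFrom s a []          _                 = refl
  gaps-blocksFrom s a (zero ∷ p)  ((() , _) ∷ _)
  gaps-blocksFrom s a (suc e ∷ p) (_ ∷ parts) = trans
    (gapsFrom-jump 0 e (sum p) free
      (trans (blocksFrom-∷ s a (suc e) p (a<⇒≢ (m<m+n a z<s))) (blocksFrom-start (other s) (a + suc e) p)))
    (cong (suc e ∷_)
      (trans (gapsFrom-cong (sum p) (a + suc e) 0 later) (gaps-blocksFrom (other s) (a + suc e) p parts)))
    where
    a<⇒≢ : ∀ {x} → a < x → x ≢ a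
    a<⇒≢ a<x = <⇒≢ a<x ∘ sym
    free : ∀ {x} → a + 0 < x → x < a + suc e → blocksFrom s a (suc e ∷ p) x ≡ nothing
    free a<x x< = trans (blocksFrom-∷ s a (suc e) p (a<⇒≢ (subst (_< _) (+-identityʳ a) a<x)))
                        (blocksFrom-below (other s) (a + suc e) p x<)
    later : ∀ {x} → a + suc e < x → blocksFrom s a (suc e ∷ p) x ≡ blocksFrom (other s) (a + suc e) p x
    later lt = blocksFrom-∷ s a (suc e) p (a<⇒≢ (<-trans (m<m+n a z<s) lt))

  module Gaps {τ : Pattern} (A : Admissible τ) where
    open Admissible A

    1<n : 1 < n
    1<n = <-≤-trans (s≤s 0<k) k<n

    first-block : ∃ λ s → τ 0 ≡ just s
    first-block with crosses z<s 1<n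
    ... | zero  , s , τ0 , _     = s , τ0
    ... | suc _ , _ , _  , s≤s () , _

    -- the block crossing x = n - 1 has to end at n
    last-block : ∃ λ s → τ N ≡ just s
    last-block with crosses (m<n⇒0<n∸m 1<n) (∸-monoʳ-< {n} {1} {0} z<s (<⇒≤ 1<n))
    ... | x , s , τx , _ , n-1<x+k = s , subst (λ x → τ x ≡ just s) x≡N τx
      where
      n≤x+k : n ≤ x + k
      n≤x+k = subst (_≤ x + k) (m∸n+n≡m (<⇒≤ 1<n)) (subst (_≤ x + k) (+-comm 1 (n ∸ 1)) n-1<x+k)
      x≡N : x ≡ N
      x≡N = trans (sym (m+n∸n≡m x k)) (cong (_∸ k) (≤-antisym (fits τx) n≤x+k))

    NoStart : ℕ → ℕ → Set
    NoStart a c = ∀ {x} → a < x → x ≤ a + c → τ x ≡ nothing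

    noStart-0 : ∀ a → NoStart a 0
    noStart-0 a a<x x≤a+0 = contradiction (subst (_ ≤_) (+-identityʳ a) x≤a+0) (<⇒≱ a<x)

    noStart-suc : ∀ {a c} → NoStart a c → τ (a + suc c) ≡ nothing → NoStart a (suc c)
    noStart-suc {a} {c} free τnext {x} a<x x≤ with m≤n⇒m<n∨m≡n x≤
    ... | inj₂ refl = τnext
    ... | inj₁ x< = free a<x (s≤s⁻¹ (subst (x <_) (+-suc a c) x<))

    gap<k : ∀ {a c} → NoStart a c → a < N → suc c < k
    gap<k {a} {c} free a<N with crosses (<-≤-trans 0<k (m≤n+m k a)) (subst (a + k <_) N+k≡n (+-monoˡ-< k a<N))
    ... | x , _ , τx , x<a+k , a+k<x+k with x ≤? a + c
    ...   | yes x≤ = case trans (sym (free (+-cancelʳ-< k a x a+k<x+k) x≤)) τx of λ ()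
    ...   | no x≰ = +-cancelˡ-< a (suc c) k (≤-<-trans (subst (_≤ x) (sym (+-suc a c)) (≰⇒> x≰)) x<a+k)

    next-in-other-strip : ∀ {a x s t} → τ a ≡ just s → τ x ≡ just t → a < x → x < a + k →
                          t ≡ other s
    next-in-other-strip {s = bottom} {top}    _  _  _   _   = refl
    next-in-other-strip {s = top}    {bottom} _  _  _   _   = refl
    next-in-other-strip {s = bottom} {bottom} τa τx a<x x<a+k = contradiction (apart τa τx a<x) (<⇒≱ x<a+k)
    next-in-other-strip {s = top}    {top}    τa τx a<x x<a+k = contradiction (apart τa τx a<x) (<⇒≱ x<a+k)

    -- of three block starts two share a strip
    three-blocks : ∀ {a x x′ s t u} → τ a ≡ just s → τ x ≡ just t → τ x′ ≡ just u →
                   a < x → x < x′ → a + k ≤ x′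
    three-blocks {s = bottom} {bottom}       τa τx _ a<x x<x′ = ≤-trans (apart τa τx a<x) (<⇒≤ x<x′)
    three-blocks {s = top}    {top}          τa τx _ a<x x<x′ = ≤-trans (apart τa τx a<x) (<⇒≤ x<x′)
    three-blocks {s = bottom} {top} {bottom} τa _ τx′ a<x x<x′ = apart τa τx′ (<-trans a<x x<x′)
    three-blocks {s = top} {bottom} {top}    τa _ τx′ a<x x<x′ = apart τa τx′ (<-trans a<x x<x′)
    three-blocks {s = bottom} {top} {top}    _ τx τx′ a<x x<x′ =
      ≤-trans (+-monoˡ-≤ k (<⇒≤ a<x)) (apart τx τx′ x<x′)
    three-blocks {s = top} {bottom} {bottom} _ τx τx′ a<x x<x′ =
      ≤-trans (+-monoˡ-≤ k (<⇒≤ a<x)) (apart τx τx′ x<x′)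

    shift : ∀ {a c f} → a + c + suc f ≡ N → a + suc c + f ≡ N
    shift {a} {c} {f} eq = trans (cong (_+ f) (+-suc a c)) (trans (sym (+-suc (a + c) f)) eq)

    restart : ∀ {a c f} → a + c + suc f ≡ N → a + suc c + 0 + f ≡ N
    restart {a} {c} {f} eq = trans (cong (_+ f) (+-identityʳ (a + suc c))) (shift eq)

    start<N : ∀ {a c f} → a + c + suc f ≡ N → a < N
    start<N {a} {c} eq = subst (a <_) eq (≤-<-trans (m≤m+n a c) (m<m+n (a + c) z<s))

    gapsFrom-sum : ∀ f a c → NoStart a c → a + c + f ≡ N → sum (gapsFrom τ a c f) ≡ c + f
    gapsFrom-sum zero a zero _ _ = refl
    gapsFrom-sum zero a (suc c) free eq with last-block
    ... | _ , τN = case trans (sym (free a<N (≤-reflexive (sym a+1+c≡N)))) τN of λ ()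
      where
      a+1+c≡N = trans (sym (+-identityʳ (a + suc c))) eq
      a<N = subst (a <_) a+1+c≡N (m<m+n a z<s)
    gapsFrom-sum (suc f) a c free eq with τ (a + suc c) in τnext
    ... | nothing = trans (gapsFrom-sum f a (suc c) (noStart-suc free τnext) (shift eq)) (sym (+-suc c f))
    ... | just _  = trans (cong (suc c +_) (gapsFrom-sum f (a + suc c) 0 (noStart-0 _) (restart eq))) (sym (+-suc c f))

    gapsFrom-parts : ∀ f a c → NoStart a c → a + c + f ≡ N → All Part (gapsFrom τ a c f)
    gapsFrom-parts zero    a c _    _  = []
    gapsFrom-parts (suc f) a c free eq with τ (a + suc c) in τnext
    ... | nothing = gapsFrom-parts f a (suc c) (noStart-suc free τnext) (shift eq)
    ... | just _  = (s≤s z≤n , <k⇒≤k∸1 (gap<k free (start<N eq)))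
                    ∷ gapsFrom-parts f (a + suc c) 0 (noStart-0 _) (restart eq)

    -- the block before the one at a starts d columns earlier and ends before every block after a;
    -- for a = 0 we take d = k, as if there were a block at −k
    PrevGap : ℕ → ℕ → Set
    PrevGap d a = ∀ {x t} → a < x → τ x ≡ just t → a + k ≤ d + x

    gapsFrom-consecutive : ∀ f a c d {s} → τ a ≡ just s → PrevGap d a → NoStart a c → a + c + f ≡ N →
                           ConsecutiveSumsAtLeast k (d ∷ gapsFrom τ a c f)
    gapsFrom-consecutive zero    a c d _  _    _    _  = tt
    gapsFrom-consecutive (suc f) a c d τa prev free eq with τ (a + suc c) in τnext
    ... | nothing = gapsFrom-consecutive f a (suc c) d τa prev (noStart-suc free τnext) (shift eq)
    ... | just _  =
      +-cancelˡ-≤ a k (d + suc c) (subst (a + k ≤_) (x∙yz≈y∙xz d a (suc c)) (prev (m<m+n a z<s) τnext)) ,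
      gapsFrom-consecutive f (a + suc c) 0 (suc c) τnext prev′ (noStart-0 _) (restart eq)
      where
      prev′ : PrevGap (suc c) (a + suc c)
      prev′ {x} a′<x τx = subst (_≤ suc c + x) (sym (xy∙z≈y∙xz a (suc c) k))
                            (+-monoʳ-≤ (suc c) (three-blocks τa τnext τx (m<m+n a z<s) a′<x))

    blocksFrom-gapsFrom : ∀ f a c {s} → τ a ≡ just s → NoStart a c → a + c + f ≡ N →
                          ∀ {x} → a ≤ x → blocksFrom s a (gapsFrom τ a c f) x ≡ τ x
    blocksFrom-gapsFrom f a c {s} τa free eq {x} a≤x with m≤n⇒m<n∨m≡n a≤x
    ... | inj₂ refl = trans (blocksFrom-start s a (gapsFrom τ a c f)) (sym τa)
    ... | inj₁ a<x  = after f c free eq a<x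
      where
      after : ∀ f c → NoStart a c → a + c + f ≡ N → a < x → blocksFrom s a (gapsFrom τ a c f) x ≡ τ x
      after zero c free eq a<x with τ x in τx
      ... | nothing = blocksFrom-[] (<⇒≢ a<x ∘ sym)
      ... | just _  = case trans (sym (free a<x x≤a+c)) τx of λ ()
        where
        x≤a+c = subst (x ≤_) (trans (sym eq) (+-identityʳ (a + c)))
                      (+-cancelʳ-≤ k x N (subst (x + k ≤_) (sym N+k≡n) (fits τx)))
      after (suc f) c free eq a<x with τ (a + suc c) in τnext
      ... | nothing = after f (suc c) (noStart-suc free τnext) (shift eq) a<x
      ... | just _  = trans (blocksFrom-∷ s a (suc c) _ (<⇒≢ a<x ∘ sym)) (by-position (x <? a + suc c))
        where
        by-position : Dec (x < a + suc c) → blocksFrom (other s) (a + suc c) (gapsFrom τ (a + suc c) 0 f) x ≡ τ x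
        by-position (yes x<) = trans (blocksFrom-below (other s) (a + suc c) (gapsFrom τ (a + suc c) 0 f) x<)
                                     (sym (free a<x (s≤s⁻¹ (subst (x <_) (+-suc a c) x<))))
        by-position (no x≮) = blocksFrom-gapsFrom f (a + suc c) 0
          (subst (λ t → τ (a + suc c) ≡ just t)
                 (next-in-other-strip τa τnext (m<m+n a z<s) (+-monoʳ-< a (gap<k free (start<N eq)))) τnext)
          (noStart-0 _) (restart eq) (≮⇒≥ x≮)

    isTComp-gaps : IsTComp N k (gaps τ)
    isTComp-gaps = gapsFrom-sum N 0 0 (noStart-0 0) refl , gapsFrom-parts N 0 0 (noStart-0 0) refl ,
      consecutiveSums-tail k (gaps τ)
        (gapsFrom-consecutive N 0 0 k (proj₂ first-block) (λ {x} _ _ → m≤m+n k x) (noStart-0 0) refl)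

    blocksFrom-gaps : ∀ {s} → τ 0 ≡ just s → ∀ x → blocksFrom s 0 (gaps τ) x ≡ τ x
    blocksFrom-gaps τ0 x = blocksFrom-gapsFrom N 0 0 τ0 (noStart-0 0) refl z≤n

module Correspondence {k n : ℕ} (0<k : 0 < k) (k<n : k < n) where
  open Patterns {k} {n} 0<k
  open Compositions 0<k k<n

  patternOfGrid : Grid (2 * k) n → Pattern
  patternOfGrid g = patternOf (markAt g)

  -- the default `bottom` is never used: an admissible pattern has a block at column 0
  firstStrip : Pattern → Strip
  firstStrip τ = fromMaybe bottom (τ 0)

  gridOf : Strip → List ℕ → Grid (2 * k) n
  gridOf s p = tabulateGrid (planeOf (blocksFrom s 0 p))

  toPair : VC k n → Strip × TComp N k
  toPair (g , [ vc ]) = firstStrip (patternOfGrid g) , gaps (patternOfGrid g) ,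
                        [ Gaps.isTComp-gaps (FromTiling.admissible-patternOf k<n (isVC⇒isVCℕ vc)) ]

  fromPair : Strip × TComp N k → VC k n
  fromPair (s , p , [ tc ]) =
    gridOf s p , [ isVCℕ⇒isVC (FromAdmissible.isVCℕ-planeOf (admissible-blocksFrom s tc)) ]

  patternOfGrid-gridOf : ∀ s {p} → IsTComp N k p → ∀ x → patternOfGrid (gridOf s p) x ≡ blocksFrom s 0 p x
  patternOfGrid-gridOf s tc x = trans (patternOf-cong (markAt-tabulateGrid _) x)
                                      (FromAdmissible.patternOf-planeOf (admissible-blocksFrom s tc) x)

  firstStrip-gridOf : ∀ s {p} → IsTComp N k p → firstStrip (patternOfGrid (gridOf s p)) ≡ s
  firstStrip-gridOf s {p} tc =
    cong (fromMaybe bottom) (trans (patternOfGrid-gridOf s tc 0) (blocksFrom-start s 0 p))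

  gaps-gridOf : ∀ s {p} → IsTComp N k p → gaps (patternOfGrid (gridOf s p)) ≡ p
  gaps-gridOf s {p} tc@(sum≡N , parts , _) = begin
    gapsFrom (patternOfGrid (gridOf s p)) 0 0 N ≡⟨ gapsFrom-cong N 0 0 (λ {x} _ → patternOfGrid-gridOf s tc x) ⟩
    gapsFrom (blocksFrom s 0 p) 0 0 N           ≡⟨ cong (gapsFrom (blocksFrom s 0 p) 0 0) (sym sum≡N) ⟩
    gapsFrom (blocksFrom s 0 p) 0 0 (sum p)     ≡⟨ gaps-blocksFrom s 0 p parts ⟩
    p                                           ∎
    where open ≡-Reasoning

  gridOf-toPair : ∀ g → IsVC k n g → gridOf (firstStrip (patternOfGrid g)) (gaps (patternOfGrid g)) ≡ g
  gridOf-toPair g vc = from-first-block (Gaps.first-block A)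
    where
    open ≡-Reasoning
    V = isVC⇒isVCℕ vc
    A = FromTiling.admissible-patternOf k<n V
    τ = patternOfGrid g
    from-first-block : (∃ λ s → τ 0 ≡ just s) → gridOf (firstStrip τ) (gaps τ) ≡ g
    from-first-block (s , τ0) = begin
      gridOf (firstStrip τ) (gaps τ)
        ≡⟨ cong (λ m → gridOf (fromMaybe bottom m) (gaps τ)) τ0 ⟩
      tabulateGrid (planeOf (blocksFrom s 0 (gaps τ)))
        ≡⟨ tabulateGrid-cong (λ {x} {y} _ _ → planeOf-cong (Gaps.blocksFrom-gaps A τ0) x y) ⟩
      tabulateGrid (planeOf τ)
        ≡⟨ tabulateGrid-cong (λ x<n y<2k → sym (FromTiling.planeOf-patternOf k<n V x<n y<2k)) ⟩
      tabulateGrid (markAt g)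
        ≡⟨ tabulateGrid-markAt g ⟩
      g ∎

  VC↔Strip×TComp : VC k n ↔ (Strip × TComp N k)
  VC↔Strip×TComp = mk↔ₛ′ toPair fromPair toPair∘fromPair fromPair∘toPair
    where
    toPair∘fromPair : ∀ y → toPair (fromPair y) ≡ y
    toPair∘fromPair (s , p , [ tc ]) =
      cong₂ _,_ (recompute (_ ≟ₛ s) (firstStrip-gridOf s tc))
                (value-injective (recompute (List.≡-dec _≟_ _ p) (gaps-gridOf s tc)))
    fromPair∘toPair : ∀ x → fromPair (toPair x) ≡ x
    fromPair∘toPair (g , [ vc ]) = value-injective (recompute (_ ≟ᴳ g) (gridOf-toPair g vc))

proposition2p5 : (n k : ℕ) → 2 ≤ k → k < n →
    Σ ℕ (λ m → HasSize (TComp (n ∸ k) k) m × HasSize (VC k n) (2 * m))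
proposition2p5 n k 2≤k k<n with finite-TComp (n ∸ k) k
... | m , TComp↔m = m , TComp↔m ,
  ↔-trans (Correspondence.VC↔Strip×TComp 0<k k<n) (↔-trans (Strip↔Fin2 ×-↔ TComp↔m) (↔-sym *↔×))
  where
  0<k : 0 < k
  0<k = ≤-trans (s≤s z≤n) 2≤k
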